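{- Let $n\geq 1$ and $k\geq 0$ be integers, let $0\leq i\leq n-1$ and $0\leq j\leq k$, and define \[ i'=\Big\lfloor \frac{(n+1)k-(k+1)i-j}{k+1}\Big\rfloor,\qquad j'=(n+1)k-(k+1)i-j-(k+1)i'. \] If $\pi\in\Gamma^k(n,i;j)$, then $\varphi(\pi)\in\Gamma^k(n,i';j')$.
   Context: For a permutation $\pi=\pi_1\cdots\pi_n$ of $[n]=\{1,\dots,n\}$, $\mathrm{des}(\pi)$ is the number of $i\in[n-1]$ with $\pi_i>\pi_{i+1}$, and $\mathrm{maxdrop}(\pi)=\max\{i-\pi_i:1\leq i\leq n\}$. $A_{n,k}$ is the set of permutations of $[n]$ with $\mathrm{maxdrop}(\pi)\leq k$. For $0\leq i\leq n-1$, $0\leq j\leq k$, $\Gamma^k(n,i;j)$ is the set of $\pi\in A_{n,k}$ with $\mathrm{des}(\pi)=i$ and $\pi_n=n-k+j$. For a permutation $\sigma$ of $[m]$ and $1\leq c\leq m+1$, $\sigma\leftarrow c$ denotes the permutation of $[m+1]$ obtained by increasing by $1$ every entry of $\sigma$ that is $\geq c$ and then appending $c$ at the end (e.g. $3421\leftarrow 3=45213$). The map $\varphi$ on $A_{n,k}$ is defined recursively: $\varphi(1)=1$ for $n=1$; for $n\geq 2$ and $\pi\in A_{n,k}$, put $i=\mathrm{des}(\pi)$, $j=\pi_n-n+k$, $i'=\lfloor((n+1)k-(k+1)i-j)/(k+1)\rfloor$, $j'=(n+1)k-(k+1)i-j-(k+1)i'$, let $\pi'$ be the permutation of $[n-1]$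 order-isomorphic to $\pi_1\cdots\pi_{n-1}$ (so $\pi=\pi'\leftarrow\pi_n$), and set $\varphi(\pi)=\varphi(\pi')\leftarrow(n-k+j')$. -}

module Defs where

open import Data.Nat as ℕ using (ℕ; zero; suc; _≤ᵇ_; _<ᵇ_)
open import Data.Integer as ℤ using (ℤ; +_; _-_; _*_; _⊔_; ∣_∣)
import Data.Integer
open import Data.Integer.DivMod using (_/ℕ_)
open import Data.Bool using (if_then_else_)
open import Data.List using (List; []; _∷_; _++_; [_]; map; upTo; length; last)
open import Data.Maybe using (Maybe; just; nothing)
open import Data.Product using (_×_; _,_)
open import Data.List.Relation.Binary.Permutation.Propositional using (_↭_)
open import Relation.Binary.PropositionalEquality using (_≡_)

-- Permutations of [n] = {1,…,n} are represented as lists of naturals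
-- (one-line notation π₁ ⋯ πₙ) that are a rearrangement of 1,2,…,n.
IsPerm : ℕ → List ℕ → Set
IsPerm n π = π ↭ map suc (upTo n)

des : List ℕ → ℕ
des [] = 0
des (x ∷ []) = 0
des (x ∷ y ∷ xs) = (if y <ᵇ x then 1 else 0) ℕ.+ des (y ∷ xs)

drops : ℕ → List ℕ → List ℤ
drops p [] = []
drops p (x ∷ xs) = (+ p - + x) ∷ drops (suc p) xs

-- maxdrop(π) = max { i - πᵢ : 1 ≤ i ≤ n }.  (The fold starts at 0, which is
-- harmless: for a permutation the drops sum to 0, so their max is ≥ 0.)
maxdrop : List ℕ → ℤ
maxdrop π = Data.List.foldr _⊔_ (+ 0) (drops 1 π)

InA : ℕ → ℕ → List ℕ → Set
InA n k π = IsPerm n π × (maxdrop π ℤ.≤ + k)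

InΓ : ℕ → ℕ → ℤ → ℤ → List ℕ → Set
InΓ k n i j π =
  InA n k π × (+ des π ≡ i) ×
  (Data.List.last π ≡ just ∣ + n - + k ℤ.+ j ∣) × (+ n - + k ℤ.+ j ≡ + ∣ + n - + k ℤ.+ j ∣)

bigN : ℕ → ℕ → ℤ → ℤ → ℤ
bigN n k i j = + (suc n ℕ.* k) - + (suc k) * i - j

-- i' = ⌊ ((n+1)k - (k+1)i - j) / (k+1) ⌋   (_/ℕ_ is floor division)
i′ : ℕ → ℕ → ℤ → ℤ → ℤ
i′ n k i j = bigN n k i j /ℕ suc k

j′ : ℕ → ℕ → ℤ → ℤ → ℤ
j′ n k i j = bigN n k i j - + (suc k) * i′ n k i j

_←_ : List ℕ → ℕ → List ℕ
σ ← c = map (λ x → if c ≤ᵇ x then suc x else x) σ ++ [ c ]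

initLast : List ℕ → Maybe (List ℕ × ℕ)
initLast [] = nothing
initLast (x ∷ xs) with initLast xs
... | nothing = just ([] , x)
... | just (ys , y) = just (x ∷ ys , y)

-- π' : the permutation order-isomorphic to π₁⋯π_{n-1}, where c = πₙ
-- (for a permutation, entries > c are decreased by one)
standardize : List ℕ → ℕ → List ℕ
standardize ρ c = map (λ x → if c <ᵇ x then x ℕ.∸ 1 else x) ρ

φstep : ℕ → ℕ → List ℕ → (List ℕ → List ℕ) → Maybe (List ℕ × ℕ) → List ℕ
φstep k n π rec nothing = []
φstep k n π rec (just (ρ , c)) =
  let i = + des π
      j = + c - + n ℤ.+ + k
  in rec (standardize ρ c) ← ∣ + n - + k ℤ.+ j′ n k i j ∣

φaux : ℕ → ℕ → List ℕ → List ℕ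
φaux k zero π = []
φaux k (suc zero) π = 1 ∷ []
φaux k (suc (suc m)) π = φstep k (suc (suc m)) π (φaux k (suc m)) (initLast π)

φ : ℕ → List ℕ → List ℕ
φ k π = φaux k (length π) π

-- Put N(π) = (k+1)(n − des π) − πₙ. By induction on n, φ(π) lies in A_{n,k}, its number of
-- descents is the quotient of N(π) by k + 1 and its last entry is n − k plus the remainder; the
-- theorem is this invariant read through the definitions of i′ and j′.
-- If π′ is the standardization of π₁⋯π_{n−1}, then N(π) = N(π′) + δ with 0 ≤ δ ≤ k. Adding δ to
-- the remainder of N(π′) either stays at most k or carries one into the quotient, and the carry
-- happens exactly when the new last entry of φ(π) is at most the last entry of φ(π′), i.e. exactly
-- when appending it creates a descent. The new last entry is positive because k + 1 divides
-- the sum of the new remainder and πₙ.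
module Submission where

open import Data.Bool using (Bool; true; false; if_then_else_)
open import Data.Integer as ℤ using (ℤ; +_; ∣_∣; _⊔_)
import Data.Integer.Properties as ℤ
import Data.Integer.Tactic.RingSolver as ℤ-Ring
open import Data.List as List
  using (List; []; _∷_; _++_; [_]; _∷ʳ_; _∷ʳ′_; map; upTo; applyUpTo; length; last; foldr)
open import Data.List.Membership.Propositional using (_∈_)
open import Data.List.Membership.Propositional.Properties using (∈-map⁻; ∈-upTo⁻; ∈-++⁺ˡ; ∈-++⁺ʳ)
open import Data.List.Properties
  using (map-++; ++-assoc; map-applyUpTo; length-map; length-upTo; length-++; last-map)
open import Data.List.Relation.Binary.Permutation.Propositional
  using (_↭_; ↭-refl; ↭-sym; ↭-trans; ↭-reflexive; ↭⇒↭ₛ)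
open import Data.List.Relation.Binary.Permutation.Propositional.Properties
  using (shift; ++⁺ˡ; ++⁺ʳ; ∷↭∷ʳ; drop-∷; ∈-resp-↭; ↭-singleton-inv; ↭-length; map⁺)
import Data.List.Relation.Binary.Permutation.Setoid.Properties as Setoid↭
open import Data.List.Relation.Unary.All as All using (All; []; _∷_)
import Data.List.Relation.Unary.All.Properties as All
open import Data.List.Relation.Unary.AllPairs using (_∷_)
open import Data.List.Relation.Unary.Any using (here)
open import Data.List.Relation.Unary.Unique.Propositional using (Unique)
import Data.List.Relation.Unary.Unique.Propositional.Properties as Unique
open import Data.Maybe as Maybe using (just)
open import Data.Maybe.Properties using (just-injective)
open import Data.Nat
  using (ℕ; zero; suc; _+_; _*_; _∸_; _≤_; _<_; _≤ᵇ_; _<ᵇ_; z≤n; s≤s; _≤?_; _<?_; >-nonZero)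
open import Data.Nat.Properties
open import Data.Nat.DivMod using (_/_; +-distrib-/-∣ʳ; m<n⇒m/n≡0; m*n/n≡m)
open import Data.Nat.Divisibility using (_∣_; divides; ∣m+n∣m⇒∣n; ∣⇒≤; m∣m*n)
open import Data.Nat.Tactic.RingSolver using (solve-∀)
open import Data.Product using (_×_; _,_; proj₁; proj₂; ∃-syntax)
open import Data.Sum using (_⊎_; inj₁; inj₂)
open import Data.Unit using (tt; ⊤)
open import Function using (_∘_; id)
open import Relation.Binary.PropositionalEquality
  using (_≡_; _≢_; refl; sym; trans; cong; cong₂; subst; subst₂; ≢-sym; setoid; module ≡-Reasoning)
open import Relation.Nullary using (yes; no; contradiction)
open import Relation.Nullary.Reflects using (Reflects; ofʸ; ofⁿ; det)

open import Defs

bit : Bool → ℕ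
bit b = if b then 1 else 0

reflects-≡ : ∀ {p q} {P : Set p} {Q : Set q} {a b : Bool} →
             Reflects P a → Reflects Q b → (P → Q) → (Q → P) → a ≡ b
reflects-≡ (ofʸ _)  (ofʸ _)  _ _ = refl
reflects-≡ (ofʸ p)  (ofⁿ ¬q) f _ = contradiction (f p) ¬q
reflects-≡ (ofⁿ ¬p) (ofʸ q)  _ g = contradiction (g q) ¬p
reflects-≡ (ofⁿ _)  (ofⁿ _)  _ _ = refl

<ᵇ-true : ∀ {m n} → m < n → (m <ᵇ n) ≡ true
<ᵇ-true {m} {n} m<n = det (<ᵇ-reflects-< m n) (ofʸ m<n)

<ᵇ-false : ∀ {m n} → n ≤ m → (m <ᵇ n) ≡ false
<ᵇ-false {m} {n} n≤m = det (<ᵇ-reflects-< m n) (ofⁿ (≤⇒≯ n≤m))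

shiftUp : ℕ → ℕ → ℕ
shiftUp c x = if c ≤ᵇ x then suc x else x

shiftDown : ℕ → ℕ → ℕ
shiftDown c x = if c <ᵇ x then x ∸ 1 else x

shiftUp-≥ : ∀ {c x} → c ≤ x → shiftUp c x ≡ suc x
shiftUp-≥ {c} {x} c≤x with c ≤ᵇ x | ≤ᵇ-reflects-≤ c x
... | true  | _       = refl
... | false | ofⁿ c≰x = contradiction c≤x c≰x

shiftUp-< : ∀ {c x} → x < c → shiftUp c x ≡ x
shiftUp-< {c} {x} x<c with c ≤ᵇ x | ≤ᵇ-reflects-≤ c x
... | true  | ofʸ c≤x = contradiction c≤x (<⇒≱ x<c)
... | false | _       = refl

shiftDown-> : ∀ {c x} → c < x → shiftDown c x ≡ x ∸ 1
shiftDown-> {c} {x} c<x with c <ᵇ x | <ᵇ-reflects-< c x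
... | true  | _       = refl
... | false | ofⁿ c≮x = contradiction c<x c≮x

shiftDown-≤ : ∀ {c x} → x ≤ c → shiftDown c x ≡ x
shiftDown-≤ {c} {x} x≤c with c <ᵇ x | <ᵇ-reflects-< c x
... | true  | ofʸ c<x = contradiction c<x (≤⇒≯ x≤c)
... | false | _       = refl

shiftUp-inflationary : ∀ c x → x ≤ shiftUp c x
shiftUp-inflationary c x with c ≤ᵇ x
... | true  = n≤1+n x
... | false = ≤-refl

shiftDown-≥-or-fixed : ∀ c x → c ≤ shiftDown c x ⊎ shiftDown c x ≡ x
shiftDown-≥-or-fixed c x with c <ᵇ x | <ᵇ-reflects-< c x
... | true  | ofʸ c<x = inj₁ (∸-monoˡ-≤ 1 c<x)
... | false | _       = inj₂ refl

shiftUp-shiftDown : ∀ {c x} → x ≢ c → shiftUp c (shiftDown c x) ≡ x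
shiftUp-shiftDown {c} {x} x≢c with c <ᵇ x | <ᵇ-reflects-< c x
... | true  | ofʸ c<x = trans (shiftUp-≥ (∸-monoˡ-≤ 1 c<x)) (m+[n∸m]≡n (≤-trans (s≤s z≤n) c<x))
... | false | ofⁿ c≮x = shiftUp-< (≤∧≢⇒< (≮⇒≥ c≮x) x≢c)

shiftUp-mono-≤ : ∀ c {x y} → x ≤ y → shiftUp c x ≤ shiftUp c y
shiftUp-mono-≤ c {x} {y} x≤y with c ≤ᵇ x | ≤ᵇ-reflects-≤ c x | c ≤ᵇ y | ≤ᵇ-reflects-≤ c y
... | true  | _       | true  | _       = s≤s x≤y
... | true  | ofʸ c≤x | false | ofⁿ c≰y = contradiction (≤-trans c≤x x≤y) c≰y
... | false | _       | true  | _       = m≤n⇒m≤1+n x≤y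
... | false | _       | false | _       = x≤y

shiftUp-mono-< : ∀ c {x y} → x < y → shiftUp c x < shiftUp c y
shiftUp-mono-< c {x} {y} x<y with c ≤ᵇ x | ≤ᵇ-reflects-≤ c x | c ≤ᵇ y | ≤ᵇ-reflects-≤ c y
... | true  | _       | true  | _       = s≤s x<y
... | true  | ofʸ c≤x | false | ofⁿ c≰y = contradiction (≤-trans c≤x (<⇒≤ x<y)) c≰y
... | false | _       | true  | _       = m<n⇒m<1+n x<y
... | false | _       | false | _       = x<y

shiftUp-<ᵇ : ∀ c x y → (shiftUp c x <ᵇ shiftUp c y) ≡ (x <ᵇ y)
shiftUp-<ᵇ c x y = reflects-≡ (<ᵇ-reflects-< _ _) (<ᵇ-reflects-< x y)
  (λ su<su → ≰⇒> (λ y≤x → <⇒≱ su<su (shiftUp-mono-≤ c y≤x)))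
  (shiftUp-mono-< c)

shiftDown-<ᵇ : ∀ {c x y} → x ≢ c → y ≢ c → (shiftDown c x <ᵇ shiftDown c y) ≡ (x <ᵇ y)
shiftDown-<ᵇ {c} {x} {y} x≢c y≢c = begin
  shiftDown c x <ᵇ shiftDown c y                         ≡⟨ shiftUp-<ᵇ c _ _ ⟨
  shiftUp c (shiftDown c x) <ᵇ shiftUp c (shiftDown c y)
    ≡⟨ cong₂ _<ᵇ_ (shiftUp-shiftDown x≢c) (shiftUp-shiftDown y≢c) ⟩
  x <ᵇ y                                                 ∎
  where open ≡-Reasoning

<ᵇ-shiftUp : ∀ c e → (c <ᵇ shiftUp c e) ≡ (c ≤ᵇ e)
<ᵇ-shiftUp c e with c ≤ᵇ e | ≤ᵇ-reflects-≤ c e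
... | true  | ofʸ c≤e = <ᵇ-true (s≤s c≤e)
... | false | ofⁿ c≰e = <ᵇ-false (≰⇒≥ c≰e)

des-∷ʳ-∷ʳ : ∀ xs y z → des (xs ∷ʳ y ∷ʳ z) ≡ des (xs ∷ʳ y) + bit (z <ᵇ y)
des-∷ʳ-∷ʳ []            y z = +-identityʳ _
des-∷ʳ-∷ʳ (x ∷ [])      y z = trans (cong (_+_ (bit (y <ᵇ x))) (des-∷ʳ-∷ʳ [] y z))
  (sym (+-assoc (bit (y <ᵇ x)) 0 (bit (z <ᵇ y))))
des-∷ʳ-∷ʳ (x ∷ x′ ∷ xs) y z = trans (cong (_+_ (bit (x′ <ᵇ x))) (des-∷ʳ-∷ʳ (x′ ∷ xs) y z))
  (sym (+-assoc (bit (x′ <ᵇ x)) (des (x′ ∷ xs ∷ʳ y)) (bit (z <ᵇ y))))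

des-map : ∀ {p} {P : ℕ → Set p} (f : ℕ → ℕ) →
          (∀ {x y} → P x → P y → (f x <ᵇ f y) ≡ (x <ᵇ y)) →
          ∀ {xs} → All P xs → des (map f xs) ≡ des xs
des-map f f-<ᵇ []              = refl
des-map f f-<ᵇ (_ ∷ [])        = refl
des-map f f-<ᵇ (px ∷ py ∷ pxs) = cong₂ (λ b d → bit b + d) (f-<ᵇ py px) (des-map f f-<ᵇ (py ∷ pxs))

last-∷ʳ : ∀ (xs : List ℕ) x → last (xs ∷ʳ x) ≡ just x
last-∷ʳ []           x = refl
last-∷ʳ (_ ∷ [])     x = refl
last-∷ʳ (_ ∷ y ∷ xs) x = last-∷ʳ (y ∷ xs) x

initLast-∷ʳ : ∀ (xs : List ℕ) x → initLast (xs ∷ʳ x) ≡ just (xs , x)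
initLast-∷ʳ []       x = refl
initLast-∷ʳ (y ∷ xs) x rewrite initLast-∷ʳ xs x = refl

des-standardize : ∀ ρ a c → All (_≢ c) (ρ ∷ʳ a) →
                  des (ρ ∷ʳ a ∷ʳ c) ≡ des (standardize (ρ ∷ʳ a) c) + bit (c <ᵇ a)
des-standardize ρ a c ρa≢c = begin
  des (ρ ∷ʳ a ∷ʳ c)                            ≡⟨ des-∷ʳ-∷ʳ ρ a c ⟩
  des (ρ ∷ʳ a) + bit (c <ᵇ a)
    ≡⟨ cong (_+ bit (c <ᵇ a)) (des-map (shiftDown c) shiftDown-<ᵇ ρa≢c) ⟨
  des (standardize (ρ ∷ʳ a) c) + bit (c <ᵇ a)  ∎
  where open ≡-Reasoning

des-← : ∀ σ c {e} → last σ ≡ just e → des (σ ← c) ≡ des σ + bit (c <ᵇ shiftUp c e)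
des-← σ c last≡ with List.initLast σ
des-← .[] c () | []
des-← .(σ ∷ʳ e) c last≡ | σ ∷ʳ′ e with refl ← just-injective (trans (sym (last-∷ʳ σ e)) last≡) = begin
  des (map f (σ ∷ʳ e) ∷ʳ c)        ≡⟨ cong (λ xs → des (xs ∷ʳ c)) (map-++ f σ [ e ]) ⟩
  des (map f σ ∷ʳ f e ∷ʳ c)        ≡⟨ des-∷ʳ-∷ʳ (map f σ) (f e) c ⟩
  des (map f σ ∷ʳ f e) + bit (c <ᵇ f e)   ≡⟨ cong (λ xs → des xs + bit (c <ᵇ f e)) (map-++ f σ [ e ]) ⟨
  des (map f (σ ∷ʳ e)) + bit (c <ᵇ f e)
    ≡⟨ cong (_+ bit (c <ᵇ f e)) (des-map f (λ _ _ → shiftUp-<ᵇ c _ _) (All.universal {P = λ _ → ⊤} (λ _ → tt) (σ ∷ʳ e))) ⟩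
  des (σ ∷ʳ e) + bit (c <ᵇ f e)           ∎
  where
  open ≡-Reasoning
  f = shiftUp c

interval : ℕ → ℕ → List ℕ
interval a zero    = []
interval a (suc l) = a ∷ interval (suc a) l

oneTo : ℕ → List ℕ
oneTo n = map suc (upTo n)

applyUpTo-interval : ∀ (f : ℕ → ℕ) a n → (∀ x → f x ≡ a + x) → applyUpTo f n ≡ interval a n
applyUpTo-interval f a zero    f≗a+ = refl
applyUpTo-interval f a (suc n) f≗a+ = cong₂ _∷_ (trans (f≗a+ 0) (+-identityʳ a))
  (applyUpTo-interval (f ∘ suc) (suc a) n (λ x → trans (f≗a+ (suc x)) (+-suc a x)))

oneTo-interval : ∀ n → oneTo n ≡ interval 1 n
oneTo-interval n = trans (map-applyUpTo id suc n) (applyUpTo-interval suc 1 n (λ _ → refl))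

interval-++ : ∀ a l₁ l₂ → interval a (l₁ + l₂) ≡ interval a l₁ ++ interval (a + l₁) l₂
interval-++ a zero     l₂ = cong (λ b → interval b l₂) (sym (+-identityʳ a))
interval-++ a (suc l₁) l₂ = cong (a ∷_) (trans (interval-++ (suc a) l₁ l₂)
  (cong (λ b → interval (suc a) l₁ ++ interval b l₂) (sym (+-suc a l₁))))

map-shiftDown-below : ∀ c a l → a + l ≤ suc c → map (shiftDown c) (interval a l) ≡ interval a l
map-shiftDown-below c a zero    _ = refl
map-shiftDown-below c a (suc l) h = cong₂ _∷_ (shiftDown-≤ (≤-pred (≤-trans (s≤s (m≤m+n a l)) h′)))
  (map-shiftDown-below c (suc a) l h′)
  where h′ = subst (_≤ suc c) (+-suc a l) h

map-shiftDown-above : ∀ c a l → c ≤ a → map (shiftDown c) (interval (suc a) l) ≡ interval a l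
map-shiftDown-above c a zero    _   = refl
map-shiftDown-above c a (suc l) c≤a =
  cong₂ _∷_ (shiftDown-> (s≤s c≤a)) (map-shiftDown-above c (suc a) l (m≤n⇒m≤1+n c≤a))

map-shiftUp-below : ∀ c a l → a + l ≤ c → map (shiftUp c) (interval a l) ≡ interval a l
map-shiftUp-below c a zero    _ = refl
map-shiftUp-below c a (suc l) h = cong₂ _∷_ (shiftUp-< (≤-trans (s≤s (m≤m+n a l)) h′))
  (map-shiftUp-below c (suc a) l h′)
  where h′ = subst (_≤ c) (+-suc a l) h

map-shiftUp-above : ∀ c a l → c ≤ a → map (shiftUp c) (interval a l) ≡ interval (suc a) l
map-shiftUp-above c a zero    _   = refl
map-shiftUp-above c a (suc l) c≤a =
  cong₂ _∷_ (shiftUp-≥ c≤a) (map-shiftUp-above c (suc a) l (m≤n⇒m≤1+n c≤a))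

-- Both are read off from oneTo (c + t) = interval 1 (c - 1) ++ c ∷ interval (c + 1) t.
map-shiftDown-oneTo : ∀ {c m} → 1 ≤ c → c ≤ suc m → map (shiftDown c) (oneTo (suc m)) ↭ c ∷ oneTo m
map-shiftDown-oneTo {suc c} {m} _ (s≤s c≤m) with m≤n⇒∃[o]m+o≡n c≤m
... | t , refl = ↭-trans (↭-reflexive split)
  (↭-trans (shift (suc c) (interval 1 c) (interval (suc c) t)) (↭-reflexive merge))
  where
  open ≡-Reasoning
  f = shiftDown (suc c)
  split : map f (oneTo (suc (c + t))) ≡ interval 1 c ++ [ suc c ] ++ interval (suc c) t
  split = begin
    map f (oneTo (suc (c + t)))              ≡⟨ cong (map f) (oneTo-interval (suc (c + t))) ⟩
    map f (interval 1 (suc (c + t)))         ≡⟨ cong (map f ∘ interval 1) (+-suc c t) ⟨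
    map f (interval 1 (c + suc t))           ≡⟨ cong (map f) (interval-++ 1 c (suc t)) ⟩
    map f (interval 1 c ++ interval (suc c) (suc t)) ≡⟨ map-++ f (interval 1 c) _ ⟩
    map f (interval 1 c) ++ f (suc c) ∷ map f (interval (suc (suc c)) t)
      ≡⟨ cong₂ _++_ (map-shiftDown-below (suc c) 1 c (n≤1+n (suc c)))
                    (cong₂ _∷_ (shiftDown-≤ ≤-refl) (map-shiftDown-above (suc c) (suc c) t ≤-refl)) ⟩
    interval 1 c ++ [ suc c ] ++ interval (suc c) t ∎
  merge : suc c ∷ interval 1 c ++ interval (suc c) t ≡ suc c ∷ oneTo (c + t)
  merge = cong (suc c ∷_) (sym (trans (oneTo-interval (c + t)) (interval-++ 1 c t)))

map-shiftUp-oneTo : ∀ {c m} → 1 ≤ c → c ≤ suc m → map (shiftUp c) (oneTo m) ∷ʳ c ↭ oneTo (suc m)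
map-shiftUp-oneTo {suc c} {m} _ (s≤s c≤m) with m≤n⇒∃[o]m+o≡n c≤m
... | t , refl = ↭-trans (↭-reflexive split)
  (↭-trans (++⁺ˡ (interval 1 c) (↭-sym (∷↭∷ʳ (suc c) (interval (suc (suc c)) t)))) (↭-reflexive merge))
  where
  open ≡-Reasoning
  g = shiftUp (suc c)
  split : map g (oneTo (c + t)) ∷ʳ suc c ≡ interval 1 c ++ (interval (suc (suc c)) t ∷ʳ suc c)
  split = begin
    map g (oneTo (c + t)) ∷ʳ suc c
      ≡⟨ cong (λ xs → map g xs ∷ʳ suc c) (trans (oneTo-interval (c + t)) (interval-++ 1 c t)) ⟩
    map g (interval 1 c ++ interval (suc c) t) ∷ʳ suc c ≡⟨ cong (_∷ʳ suc c) (map-++ g (interval 1 c) _) ⟩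
    (map g (interval 1 c) ++ map g (interval (suc c) t)) ∷ʳ suc c
      ≡⟨ cong (_∷ʳ suc c) (cong₂ _++_ (map-shiftUp-below (suc c) 1 c ≤-refl)
                                       (map-shiftUp-above (suc c) (suc c) t ≤-refl)) ⟩
    (interval 1 c ++ interval (suc (suc c)) t) ∷ʳ suc c ≡⟨ ++-assoc (interval 1 c) _ _ ⟩
    interval 1 c ++ (interval (suc (suc c)) t ∷ʳ suc c) ∎
  merge : interval 1 c ++ (suc c ∷ interval (suc (suc c)) t) ≡ oneTo (suc (c + t))
  merge = sym (begin
    oneTo (suc (c + t))             ≡⟨ oneTo-interval (suc (c + t)) ⟩
    interval 1 (suc (c + t))        ≡⟨ cong (interval 1) (+-suc c t) ⟨
    interval 1 (c + suc t)          ≡⟨ interval-++ 1 c (suc t) ⟩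
    interval 1 c ++ (suc c ∷ interval (suc (suc c)) t) ∎)

length-oneTo : ∀ n → length (oneTo n) ≡ n
length-oneTo n = trans (length-map suc (upTo n)) (length-upTo n)

∈-oneTo⁻ : ∀ {x n} → x ∈ oneTo n → 1 ≤ x × x ≤ n
∈-oneTo⁻ x∈ with ∈-map⁻ suc x∈
... | y , y∈ , refl = s≤s z≤n , ∈-upTo⁻ y∈

oneTo-unique : ∀ n → Unique (oneTo n)
oneTo-unique n = Unique.map⁺ suc-injective (Unique.upTo⁺ n)

∷ʳ-perm-fresh : ∀ {n} ρ c → ρ ∷ʳ c ↭ oneTo n → All (_≢ c) ρ
∷ʳ-perm-fresh ρ c p with Setoid↭.Unique-resp-↭ (setoid ℕ) (↭⇒↭ₛ (↭-sym (↭-trans (∷↭∷ʳ c ρ) p))) (oneTo-unique _)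
... | c∉ρ ∷ _ = All.map ≢-sym c∉ρ

∷ʳ-perm-last : ∀ {n} ρ c → ρ ∷ʳ c ↭ oneTo n → 1 ≤ c × c ≤ n
∷ʳ-perm-last ρ c p = ∈-oneTo⁻ (∈-resp-↭ p (∈-++⁺ʳ ρ (here refl)))

standardize-perm : ∀ {m} ρ c → ρ ∷ʳ c ↭ oneTo (suc m) → standardize ρ c ↭ oneTo m
standardize-perm ρ c p = drop-∷ (↭-trans (↭-reflexive (cong (_∷ standardize ρ c) (sym (shiftDown-≤ ≤-refl))))
  (↭-trans (map⁺ (shiftDown c) (↭-trans (∷↭∷ʳ c ρ) p)) (map-shiftDown-oneTo 1≤c c≤n)))
  where
  1≤c = proj₁ (∷ʳ-perm-last ρ c p)
  c≤n = proj₂ (∷ʳ-perm-last ρ c p)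

←-perm : ∀ {m} σ c → σ ↭ oneTo m → 1 ≤ c → c ≤ suc m → σ ← c ↭ oneTo (suc m)
←-perm σ c p 1≤c c≤n = ↭-trans (++⁺ʳ [ c ] (map⁺ (shiftUp c) p)) (map-shiftUp-oneTo 1≤c c≤n)

DropsAtMost : ℕ → ℕ → List ℕ → Set
DropsAtMost k p []       = ⊤
DropsAtMost k p (x ∷ xs) = p ≤ x + k × DropsAtMost k (suc p) xs

[i-j]+j≡i : ∀ (i j : ℤ) → i ℤ.- j ℤ.+ j ≡ i
[i-j]+j≡i = ℤ-Ring.solve-∀

[i+j]-j≡i : ∀ (i j : ℤ) → i ℤ.+ j ℤ.- j ≡ i
[i+j]-j≡i = ℤ-Ring.solve-∀

drop≤⇒ : ∀ {p x k} → + p ℤ.- + x ℤ.≤ + k → p ≤ x + k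
drop≤⇒ {p} {x} {k} h = subst (p ≤_) (+-comm k x)
  (ℤ.drop‿+≤+ (subst (ℤ._≤ + k ℤ.+ + x) ([i-j]+j≡i (+ p) (+ x)) (ℤ.+-monoˡ-≤ (+ x) h)))

⇒drop≤ : ∀ {p x k} → p ≤ x + k → + p ℤ.- + x ℤ.≤ + k
⇒drop≤ {p} {x} {k} h = subst (+ p ℤ.- + x ℤ.≤_) ([i+j]-j≡i (+ k) (+ x))
  (ℤ.+-monoˡ-≤ (ℤ.- + x) (ℤ.+≤+ (subst (p ≤_) (+-comm x k) h)))

maxdrop≤⇒DropsAtMost : ∀ {k} p xs → foldr _⊔_ (+ 0) (drops p xs) ℤ.≤ + k → DropsAtMost k p xs
maxdrop≤⇒DropsAtMost p []       _ = tt
maxdrop≤⇒DropsAtMost p (x ∷ xs) h =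
  drop≤⇒ (ℤ.≤-trans (ℤ.i≤i⊔j _ _) h) , maxdrop≤⇒DropsAtMost (suc p) xs (ℤ.≤-trans (ℤ.i≤j⊔i _ _) h)

DropsAtMost⇒maxdrop≤ : ∀ {k} p xs → DropsAtMost k p xs → foldr _⊔_ (+ 0) (drops p xs) ℤ.≤ + k
DropsAtMost⇒maxdrop≤ p []       _        = ℤ.+≤+ z≤n
DropsAtMost⇒maxdrop≤ p (x ∷ xs) (h , hs) = ℤ.⊔-lub (⇒drop≤ h) (DropsAtMost⇒maxdrop≤ (suc p) xs hs)

DropsAtMost-++⁻ : ∀ {k} p xs {ys} → DropsAtMost k p (xs ++ ys) →
                  DropsAtMost k p xs × DropsAtMost k (p + length xs) ys
DropsAtMost-++⁻ {k} p []       {ys} h = tt , subst (λ q → DropsAtMost k q ys) (sym (+-identityʳ p)) h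
DropsAtMost-++⁻ {k} p (x ∷ xs) {ys} (h , hs) with DropsAtMost-++⁻ (suc p) xs hs
... | hxs , hys = (h , hxs) , subst (λ q → DropsAtMost k q ys) (sym (+-suc p (length xs))) hys

DropsAtMost-++⁺ : ∀ {k} p xs {ys} → DropsAtMost k p xs → DropsAtMost k (p + length xs) ys →
                  DropsAtMost k p (xs ++ ys)
DropsAtMost-++⁺ {k} p []       {ys} _          hys = subst (λ q → DropsAtMost k q ys) (+-identityʳ p) hys
DropsAtMost-++⁺ {k} p (x ∷ xs) {ys} (h , hxs) hys =
  h , DropsAtMost-++⁺ (suc p) xs hxs (subst (λ q → DropsAtMost k q ys) (+-suc p (length xs)) hys)

DropsAtMost-last : ∀ {k p} xs x → DropsAtMost k p (xs ∷ʳ x) → p + length xs ≤ x + k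
DropsAtMost-last xs x h = proj₁ (proj₂ (DropsAtMost-++⁻ _ xs h))

DropsAtMost-map : ∀ {k} (f : ℕ → ℕ) → (∀ x → x ≤ f x) →
                  ∀ {p} xs → DropsAtMost k p xs → DropsAtMost k p (map f xs)
DropsAtMost-map f f-infl []       _        = tt
DropsAtMost-map f f-infl (x ∷ xs) (h , hs) = ≤-trans h (+-monoˡ-≤ _ (f-infl x)) , DropsAtMost-map f f-infl xs hs

DropsAtMost-standardize : ∀ {k c p} ρ → p + length ρ ≤ suc (c + k) →
                          DropsAtMost k p ρ → DropsAtMost k p (standardize ρ c)
DropsAtMost-standardize []       _ _        = tt
DropsAtMost-standardize {k} {c} {p} (x ∷ ρ) bound (h , hs) =
  entry (shiftDown-≥-or-fixed c x) , DropsAtMost-standardize ρ bound′ hs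
  where
  bound′ = subst (_≤ suc (c + k)) (+-suc p (length ρ)) bound
  entry : c ≤ shiftDown c x ⊎ shiftDown c x ≡ x → p ≤ shiftDown c x + k
  entry (inj₁ c≤x′) = ≤-trans (≤-pred (≤-trans (s≤s (m≤m+n p (length ρ))) bound′)) (+-monoˡ-≤ k c≤x′)
  entry (inj₂ x′≡x) = subst (λ y → p ≤ y + k) (sym x′≡x) h

←-drops : ∀ {k m} σ c → length σ ≡ m → suc m ≤ c + k → DropsAtMost k 1 σ → DropsAtMost k 1 (σ ← c)
←-drops σ c length≡ last-bound h = DropsAtMost-++⁺ 1 (map (shiftUp c) σ)
  (DropsAtMost-map (shiftUp c) (shiftUp-inflationary c) σ h)
  (subst (λ l → suc l ≤ c + _) (sym (trans (length-map (shiftUp c) σ) length≡)) last-bound , tt)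

standardize-gap : ∀ {k a c} → a ≢ c → a ≤ c + suc k → c ≤ a + suc k →
                  ∃[ δ ] δ ≤ k × δ + c + suc k * bit (c <ᵇ a) ≡ shiftDown c a + suc k
standardize-gap {k} {a} {c} a≢c a≤c+K c≤a+K with c <? a
... | yes c<a with m≤n⇒∃[o]m+o≡n c<a
...   | δ , refl = δ , δ≤k , eq
  where
  open ≡-Reasoning
  δ≤k : δ ≤ k
  δ≤k = +-cancelˡ-≤ c δ k (≤-pred (subst (suc (c + δ) ≤_) (+-suc c k) a≤c+K))
  eq : δ + c + suc k * bit (c <ᵇ a) ≡ shiftDown c a + suc k
  eq = begin
    δ + c + suc k * bit (c <ᵇ a) ≡⟨ cong (λ b → δ + c + suc k * bit b) (<ᵇ-true c<a) ⟩
    δ + c + suc k * 1            ≡⟨ cong₂ _+_ (+-comm δ c) (*-identityʳ (suc k)) ⟩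
    c + δ + suc k                ≡⟨ cong (_+ suc k) (shiftDown-> c<a) ⟨
    shiftDown c a + suc k        ∎
standardize-gap {k} {a} {c} a≢c a≤c+K c≤a+K | no c≮a with m≤n⇒∃[o]m+o≡n c≤a+K
... | δ , c+δ≡a+K = δ , δ≤k , eq
  where
  open ≡-Reasoning
  a<c = ≤∧≢⇒< (≮⇒≥ c≮a) a≢c
  δ≤k : δ ≤ k
  δ≤k = ≤-pred (+-cancelˡ-< c δ (suc k) (subst (_< c + suc k) (sym c+δ≡a+K) (+-monoˡ-< (suc k) a<c)))
  eq : δ + c + suc k * bit (c <ᵇ a) ≡ shiftDown c a + suc k
  eq = begin
    δ + c + suc k * bit (c <ᵇ a) ≡⟨ cong (λ b → δ + c + suc k * bit b) (<ᵇ-false (≮⇒≥ c≮a)) ⟩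
    δ + c + suc k * 0            ≡⟨ cong (_+_ (δ + c)) (*-zeroʳ (suc k)) ⟩
    δ + c + 0                    ≡⟨ trans (+-identityʳ (δ + c)) (+-comm δ c) ⟩
    c + δ                        ≡⟨ c+δ≡a+K ⟩
    a + suc k                    ≡⟨ cong (_+ suc k) (shiftDown-≤ (≮⇒≥ c≮a)) ⟨
    shiftDown c a + suc k        ∎

carry-split : ∀ {k r₀ δ} → r₀ ≤ k → δ ≤ k → ∃[ r ] r ≤ k × r + suc k * bit (r <ᵇ r₀) ≡ r₀ + δ
carry-split {k} {r₀} {δ} r₀≤k δ≤k with r₀ + δ ≤? k
... | yes r₀+δ≤k = r₀ + δ , r₀+δ≤k , eq
  where
  eq : r₀ + δ + suc k * bit (r₀ + δ <ᵇ r₀) ≡ r₀ + δ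
  eq = trans (cong (λ b → r₀ + δ + suc k * bit b) (<ᵇ-false (m≤m+n r₀ δ)))
    (trans (cong (_+_ (r₀ + δ)) (*-zeroʳ (suc k))) (+-identityʳ (r₀ + δ)))
... | no r₀+δ≰k with m≤n⇒∃[o]m+o≡n (≰⇒> r₀+δ≰k)
...   | r , K+r≡r₀+δ = r , <⇒≤ r<k , eq
  where
  r₀+δ<K+r₀ : r₀ + δ < suc k + r₀
  r₀+δ<K+r₀ = subst (r₀ + δ <_) (+-comm r₀ (suc k)) (+-monoʳ-< r₀ (s≤s δ≤k))
  r<r₀ : r < r₀
  r<r₀ = +-cancelˡ-< (suc k) r r₀ (subst (_< suc k + r₀) (sym K+r≡r₀+δ) r₀+δ<K+r₀)
  r<k : r < k
  r<k = +-cancelˡ-< k r k (subst (_≤ k + k) (sym K+r≡r₀+δ) (+-mono-≤ r₀≤k δ≤k))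
  eq : r + suc k * bit (r <ᵇ r₀) ≡ r₀ + δ
  eq = trans (cong (λ b → r + suc k * bit b) (<ᵇ-true r<r₀)) 
    (trans (cong (_+_ r) (*-identityʳ (suc k))) (trans (+-comm r (suc k)) K+r≡r₀+δ))

division-step : ∀ {K m q₀ r₀ d i c b δ r t} →
  K * q₀ + r₀ + d + K * i ≡ K * m →
  δ + c + K * b ≡ d + K →
  r + K * t ≡ r₀ + δ →
  K * (q₀ + t) + r + c + K * (i + b) ≡ K * suc m
division-step {K} {m} {q₀} {r₀} {d} {i} {c} {b} {δ} {r} {t} step gap carry = begin
  K * (q₀ + t) + r + c + K * (i + b)          ≡⟨ regroup₁ K q₀ t r c i b ⟩
  K * q₀ + (r + K * t) + K * i + (c + K * b)  ≡⟨ cong (λ x → K * q₀ + x + K * i + (c + K * b)) carry ⟩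
  K * q₀ + (r₀ + δ) + K * i + (c + K * b)     ≡⟨ regroup₂ K q₀ r₀ δ i c b ⟩
  K * q₀ + r₀ + K * i + (δ + c + K * b)       ≡⟨ cong (_+_ (K * q₀ + r₀ + K * i)) gap ⟩
  K * q₀ + r₀ + K * i + (d + K)               ≡⟨ regroup₃ K q₀ r₀ i d ⟩
  K * q₀ + r₀ + d + K * i + K                 ≡⟨ cong (_+ K) step ⟩
  K * m + K                                   ≡⟨ +-comm (K * m) K ⟩
  K + K * m                                   ≡⟨ *-suc K m ⟨
  K * suc m                                   ∎
  where
  open ≡-Reasoning
  regroup₁ : ∀ K q₀ t r c i b → K * (q₀ + t) + r + c + K * (i + b) ≡ K * q₀ + (r + K * t) + K * i + (c + K * b)
  regroup₁ = solve-∀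
  regroup₂ : ∀ K q₀ r₀ δ i c b → K * q₀ + (r₀ + δ) + K * i + (c + K * b) ≡ K * q₀ + r₀ + K * i + (δ + c + K * b)
  regroup₂ = solve-∀
  regroup₃ : ∀ K q₀ r₀ i d → K * q₀ + r₀ + K * i + (d + K) ≡ K * q₀ + r₀ + d + K * i + K
  regroup₃ = solve-∀

-- r + c = (k + 1)(n − q − i) is positive, hence at least k + 1.
remainder-lower-bound : ∀ {k n q r c i} → 1 ≤ c → c ≤ n →
  suc k * q + r + c + suc k * i ≡ suc k * n → k < n + r
remainder-lower-bound {k} {n} {q} {r} {c} {i} 1≤c c≤n division =
  ≤-trans K≤r+c (subst (r + c ≤_) (+-comm r n) (+-monoʳ-≤ r c≤n))
  where
  regroup : ∀ K q r c i → K * q + r + c + K * i ≡ K * (q + i) + (r + c)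
  regroup = solve-∀
  K∣r+c : suc k ∣ r + c
  K∣r+c = ∣m+n∣m⇒∣n (subst (suc k ∣_) (trans (sym division) (regroup (suc k) q r c i)) (m∣m*n n))
                     (m∣m*n (q + i))
  K≤r+c : suc k ≤ r + c
  K≤r+c = ∣⇒≤ ⦃ >-nonZero (≤-trans 1≤c (m≤n+m c r)) ⦄ K∣r+c

remainder-entry : ∀ {k n q r c i} → 1 ≤ c → c ≤ n → r ≤ k →
  suc k * q + r + c + suc k * i ≡ suc k * n →
  ∃[ c′ ] c′ + k ≡ n + r × 1 ≤ c′ × c′ ≤ n
remainder-entry {k} {n} {q} {r} {c} {i} 1≤c c≤n r≤k division =
  n + r ∸ k , m∸n+n≡m (<⇒≤ k<n+r) , m<n⇒0<n∸m k<n+r ,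
  subst (n + r ∸ k ≤_) (m+n∸n≡m n k) (∸-monoˡ-≤ k (+-monoʳ-≤ n r≤k))
  where k<n+r = remainder-lower-bound {k} {n} {q} {r} {c} {i} 1≤c c≤n division

insertion-descent : ∀ {k m r r₀ c e} → c + k ≡ suc m + r → e + k ≡ m + r₀ → (c <ᵇ shiftUp c e) ≡ (r <ᵇ r₀)
insertion-descent {k} {m} {r} {r₀} {c} {e} c-offset e-offset =
  trans (<ᵇ-shiftUp c e) (reflects-≡ (≤ᵇ-reflects-≤ c e) (<ᵇ-reflects-< r r₀) to from)
  where
  c-offset′ : c + k ≡ m + suc r
  c-offset′ = trans c-offset (sym (+-suc m r))
  to : c ≤ e → r < r₀
  to c≤e = +-cancelˡ-≤ m (suc r) r₀ (subst₂ _≤_ c-offset′ e-offset (+-monoˡ-≤ k c≤e))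
  from : r < r₀ → c ≤ e
  from r<r₀ = +-cancelʳ-≤ k c e (subst₂ _≤_ (sym c-offset′) (sym e-offset) (+-monoʳ-≤ m r<r₀))

[1+k]*q+r/[1+k]≡q : ∀ {k q r} → r ≤ k → (suc k * q + r) / suc k ≡ q
[1+k]*q+r/[1+k]≡q {k} {q} {r} r≤k = begin
  (suc k * q + r) / suc k  ≡⟨ cong (_/ suc k) (trans (+-comm (suc k * q) r) (cong (_+_ r) (*-comm (suc k) q))) ⟩
  (r + q * suc k) / suc k  ≡⟨ +-distrib-/-∣ʳ r (divides q refl) ⟩
  r / suc k + q * suc k / suc k ≡⟨ cong₂ _+_ (m<n⇒m/n≡0 (s≤s r≤k)) (m*n/n≡m q (suc k)) ⟩
  q                        ∎
  where open ≡-Reasoning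

module _ {n k i q r c : ℕ} (j : ℤ) (r≤k : r ≤ k) (division : suc k * q + r + c + suc k * i ≡ suc k * n)
         (j-offset : j ℤ.+ + n ≡ + c ℤ.+ + k) where

  bigN≡[1+k]*q+r : bigN n k (+ i) j ≡ + (suc k * q + r)
  bigN≡[1+k]*q+r = begin
    + (suc n * k) ℤ.- + suc k ℤ.* + i ℤ.- j  ≡⟨ cong (λ x → + (suc n * k) ℤ.- x ℤ.- j) (ℤ.pos-* (suc k) i) ⟨
    + (suc n * k) ℤ.- + (suc k * i) ℤ.- j    ≡⟨ cancel (cong +_ balance) ⟩
    + (suc k * q + r)                        ∎
    where
    open ≡-Reasoning
    regroup₁ : ∀ n k → suc n * k + n ≡ suc k * n + k
    regroup₁ = solve-∀
    regroup₂ : ∀ K q r c i k → K * q + r + c + K * i + k ≡ K * i + c + k + (K * q + r)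
    regroup₂ = solve-∀
    balance : suc n * k + n ≡ suc k * i + c + k + (suc k * q + r)
    balance = begin
      suc n * k + n                       ≡⟨ regroup₁ n k ⟩
      suc k * n + k                       ≡⟨ cong (_+ k) division ⟨
      suc k * q + r + c + suc k * i + k   ≡⟨ regroup₂ (suc k) q r c i k ⟩
      suc k * i + c + k + (suc k * q + r) ∎
    shift-by-n : ∀ A B J N → A ℤ.- B ℤ.- J ≡ (A ℤ.+ N) ℤ.- B ℤ.- (J ℤ.+ N)
    shift-by-n = ℤ-Ring.solve-∀
    collapse : ∀ B C K M → (B ℤ.+ C ℤ.+ K ℤ.+ M) ℤ.- B ℤ.- (C ℤ.+ K) ≡ M
    collapse = ℤ-Ring.solve-∀
    cancel : + (suc n * k) ℤ.+ + n ≡ + (suc k * i) ℤ.+ + c ℤ.+ + k ℤ.+ + (suc k * q + r) →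
             + (suc n * k) ℤ.- + (suc k * i) ℤ.- j ≡ + (suc k * q + r)
    cancel A+n≡B+c+k+M = begin
      + (suc n * k) ℤ.- + (suc k * i) ℤ.- j                   ≡⟨ shift-by-n (+ (suc n * k)) (+ (suc k * i)) j (+ n) ⟩
      (+ (suc n * k) ℤ.+ + n) ℤ.- + (suc k * i) ℤ.- (j ℤ.+ + n)
        ≡⟨ cong₂ (λ x y → x ℤ.- + (suc k * i) ℤ.- y) A+n≡B+c+k+M j-offset ⟩
      (+ (suc k * i) ℤ.+ + c ℤ.+ + k ℤ.+ + (suc k * q + r)) ℤ.- + (suc k * i) ℤ.- (+ c ℤ.+ + k)
                                                              ≡⟨ collapse (+ (suc k * i)) (+ c) (+ k) (+ (suc k * q + r)) ⟩
      + (suc k * q + r)                                       ∎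

  i′-quotient : i′ n k (+ i) j ≡ + q
  i′-quotient = trans (cong (ℤ._/ℕ suc k) bigN≡[1+k]*q+r) (cong +_ ([1+k]*q+r/[1+k]≡q r≤k))

  j′-remainder : j′ n k (+ i) j ≡ + r
  j′-remainder = begin
    bigN n k (+ i) j ℤ.- + suc k ℤ.* i′ n k (+ i) j
      ≡⟨ cong₂ (λ x y → x ℤ.- + suc k ℤ.* y) bigN≡[1+k]*q+r i′-quotient ⟩
    + (suc k * q) ℤ.+ + r ℤ.- + suc k ℤ.* + q       ≡⟨ cong (λ y → + (suc k * q) ℤ.+ + r ℤ.- y) (ℤ.pos-* (suc k) q) ⟨
    + (suc k * q) ℤ.+ + r ℤ.- + (suc k * q)         ≡⟨ cancel (+ (suc k * q)) (+ r) ⟩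
    + r                                             ∎
    where
    open ≡-Reasoning
    cancel : ∀ A R → A ℤ.+ R ℤ.- A ≡ R
    cancel = ℤ-Ring.solve-∀

-- σ ∈ A_{n,k}, and dividing (k+1)(n − des π) − c by k + 1 gives quotient des σ and remainder σₙ − (n − k).
record Image (k n : ℕ) (π : List ℕ) (c : ℕ) (σ : List ℕ) : Set where
  field
    σₙ rem    : ℕ
    perm      : σ ↭ oneTo n
    drops≤    : DropsAtMost k 1 σ
    last-σ    : last σ ≡ just σₙ
    rem≤k     : rem ≤ k
    σₙ-offset : σₙ + k ≡ n + rem
    division  : suc k * des σ + rem + c + suc k * des π ≡ suc k * n

Image-i′ : ∀ {k n π c σ} (j : ℤ) → j ℤ.+ + n ≡ + c ℤ.+ + k → Image k n π c σ →
           i′ n k (+ des π) j ≡ + des σ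
Image-i′ {k} {n} {π} {c} {σ} j j-offset img =
  i′-quotient {n} {k} {des π} {des σ} {rem} {c} j rem≤k division j-offset
  where open Image img

Image-j′ : ∀ {k n π c σ} (j : ℤ) → j ℤ.+ + n ≡ + c ℤ.+ + k → (img : Image k n π c σ) →
             + n ℤ.- + k ℤ.+ j′ n k (+ des π) j ≡ + Image.σₙ img
Image-j′ {k} {n} {π} {c} {σ} j j-offset img = begin
  + n ℤ.- + k ℤ.+ j′ n k (+ des π) j
    ≡⟨ cong (ℤ._+_ (+ n ℤ.- + k)) (j′-remainder {n} {k} {des π} {des σ} {rem} {c} j rem≤k division j-offset) ⟩
  + n ℤ.- + k ℤ.+ + rem      ≡⟨ swap (+ n) (+ k) (+ rem) ⟩
  + (n + rem) ℤ.- + k        ≡⟨ cong (λ x → + x ℤ.- + k) σₙ-offset ⟨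
  + σₙ ℤ.+ + k ℤ.- + k       ≡⟨ [i+j]-j≡i (+ σₙ) (+ k) ⟩
  + σₙ                       ∎
  where
  open ≡-Reasoning
  open Image img
  swap : ∀ N K R → N ℤ.- K ℤ.+ R ≡ N ℤ.+ R ℤ.- K
  swap = ℤ-Ring.solve-∀

Image⇒InΓ : ∀ {k n π c σ} (j : ℤ) → j ℤ.+ + n ≡ + c ℤ.+ + k → Image k n π c σ →
            InΓ k n (i′ n k (+ des π) j) (j′ n k (+ des π) j) σ
Image⇒InΓ j j-offset img =
  (perm , DropsAtMost⇒maxdrop≤ 1 _ drops≤) , sym (Image-i′ j j-offset img) ,
  trans last-σ (cong (just ∘ ∣_∣) (sym value)) , trans value (cong (+_ ∘ ∣_∣) (sym value))
  where
  open Image img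
  value = Image-j′ j j-offset img

←-image : ∀ {k m π π′ c d′ σ δ b} → 1 ≤ c → c ≤ suc (suc m) → δ ≤ k →
          des π ≡ des π′ + b → δ + c + suc k * b ≡ d′ + suc k →
          Image k (suc m) π′ d′ σ → ∃[ c″ ] Image k (suc (suc m)) π c (σ ← c″)
←-image {k} {m} {π} {π′} {c} {d′} {σ} {δ} {b} 1≤c c≤n δ≤k des≡ gap img
  with carry-split (Image.rem≤k img) δ≤k
... | r , r≤k , carry
  with division′ ← subst (λ i → suc k * (des σ + bit (r <ᵇ Image.rem img)) + r + c + suc k * i ≡ suc k * suc (suc m))
                         (sym des≡)
                         (division-step {suc k} {suc m} {des σ} {Image.rem img} {d′} {des π′} {c} {b} {δ} {r}
                                        (Image.division img) gap carry)
  with remainder-entry {k} {suc (suc m)} {des σ + bit (r <ᵇ Image.rem img)} {r} {c} {des π}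
                       1≤c c≤n r≤k division′
... | c″ , c″-offset , 1≤c″ , c″≤n = c″ , record
  { σₙ        = c″
  ; rem       = r
  ; perm      = ←-perm σ c″ IH.perm 1≤c″ c″≤n
  ; drops≤    = ←-drops σ c″ (trans (↭-length IH.perm) (length-oneTo _))
                  (subst (suc (suc m) ≤_) (sym c″-offset) (m≤m+n _ r)) IH.drops≤
  ; last-σ    = last-∷ʳ (map (shiftUp c″) σ) c″
  ; rem≤k     = r≤k
  ; σₙ-offset = c″-offset
  ; division  = subst (λ d → suc k * d + r + c + suc k * des π ≡ suc k * suc (suc m)) (sym des-new) division′
  }
  where
  module IH = Image img
  des-new : des (σ ← c″) ≡ des σ + bit (r <ᵇ IH.rem)
  des-new = trans (des-← σ c″ IH.last-σ)
    (cong (λ x → des σ + bit x) (insertion-descent {k} {suc m} {r} {IH.rem} {c″} {IH.σₙ} c″-offset IH.σₙ-offset))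

length-∷ʳ : ∀ (xs : List ℕ) x → length (xs ∷ʳ x) ≡ suc (length xs)
length-∷ʳ xs x = trans (length-++ xs) (+-comm (length xs) 1)

∷ʳ∷ʳ-gap : ∀ {k m} ρ a c → ρ ∷ʳ a ∷ʳ c ↭ oneTo (suc (suc m)) → DropsAtMost k 1 (ρ ∷ʳ a ∷ʳ c) →
           ∃[ δ ] δ ≤ k × δ + c + suc k * bit (c <ᵇ a) ≡ shiftDown c a + suc k
∷ʳ∷ʳ-gap {k} {m} ρ a c perm drops≤ = standardize-gap a≢c a≤c+K c≤a+K
  where
  a≢c : a ≢ c
  a≢c = proj₂ (All.∷ʳ⁻ (∷ʳ-perm-fresh (ρ ∷ʳ a) c perm))
  length-ρa : length (ρ ∷ʳ a) ≡ suc m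
  length-ρa = suc-injective
    (trans (sym (length-∷ʳ (ρ ∷ʳ a) c)) (trans (↭-length perm) (length-oneTo _)))
  n≤c+k : suc (suc m) ≤ c + k
  n≤c+k = subst (λ l → suc l ≤ c + k) length-ρa (DropsAtMost-last (ρ ∷ʳ a) c drops≤)
  n≤a+K : suc (suc m) ≤ a + suc k
  n≤a+K = subst (suc (suc m) ≤_) (sym (+-suc a k))
    (s≤s (subst (λ l → suc l ≤ a + k) (suc-injective (trans (sym (length-∷ʳ ρ a)) length-ρa))
      (DropsAtMost-last ρ a (proj₁ (DropsAtMost-++⁻ 1 (ρ ∷ʳ a) drops≤)))))
  a≤n : a ≤ suc (suc m)
  a≤n = proj₂ (∈-oneTo⁻ (∈-resp-↭ perm (∈-++⁺ˡ (∈-++⁺ʳ ρ (here refl)))))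
  a≤c+K : a ≤ c + suc k
  a≤c+K = ≤-trans a≤n (≤-trans n≤c+k (+-monoʳ-≤ c (n≤1+n k)))
  c≤a+K : c ≤ a + suc k
  c≤a+K = ≤-trans (proj₂ (∷ʳ-perm-last (ρ ∷ʳ a) c perm)) n≤a+K

standardize-drops : ∀ {k} ρ c → DropsAtMost k 1 (ρ ∷ʳ c) → DropsAtMost k 1 (standardize ρ c)
standardize-drops ρ c h =
  DropsAtMost-standardize ρ (m≤n⇒m≤1+n (DropsAtMost-last ρ c h)) (proj₁ (DropsAtMost-++⁻ 1 ρ h))

last-standardize : ∀ ρ a c → last (standardize (ρ ∷ʳ a) c) ≡ just (shiftDown c a)
last-standardize ρ a c =
  trans (last-map (shiftDown c) (ρ ∷ʳ a)) (cong (Maybe.map (shiftDown c)) (last-∷ʳ ρ a))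

φaux-∷ʳ∷ʳ-image : ∀ {k m} ρ a c → ρ ∷ʳ a ∷ʳ c ↭ oneTo (suc (suc m)) → DropsAtMost k 1 (ρ ∷ʳ a ∷ʳ c) →
  Image k (suc m) (standardize (ρ ∷ʳ a) c) (shiftDown c a) (φaux k (suc m) (standardize (ρ ∷ʳ a) c)) →
  Image k (suc (suc m)) (ρ ∷ʳ a ∷ʳ c) c (φaux k (suc (suc m)) (ρ ∷ʳ a ∷ʳ c))
φaux-∷ʳ∷ʳ-image {k} {m} ρ a c perm drops≤ img = unfold (extend (∷ʳ∷ʳ-gap ρ a c perm drops≤))
  where
  n = suc (suc m)
  π = ρ ∷ʳ a ∷ʳ c
  σ = φaux k (suc m) (standardize (ρ ∷ʳ a) c)
  extend : ∃[ δ ] δ ≤ k × δ + c + suc k * bit (c <ᵇ a) ≡ shiftDown c a + suc k →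
           ∃[ c″ ] Image k n π c (σ ← c″)
  extend (δ , δ≤k , gap) =
    ←-image (proj₁ (∷ʳ-perm-last (ρ ∷ʳ a) c perm)) (proj₂ (∷ʳ-perm-last (ρ ∷ʳ a) c perm)) δ≤k
            (des-standardize ρ a c (∷ʳ-perm-fresh (ρ ∷ʳ a) c perm)) gap img
  j-offset : (+ c ℤ.- + n ℤ.+ + k) ℤ.+ + n ≡ + c ℤ.+ + k
  j-offset = ring (+ c) (+ n) (+ k)
    where ring : ∀ C N K → (C ℤ.- N ℤ.+ K) ℤ.+ N ≡ C ℤ.+ K
          ring = ℤ-Ring.solve-∀
  unfold : ∃[ c″ ] Image k n π c (σ ← c″) → Image k n π c (φaux k n π)
  unfold (c″ , image) = subst (Image k n π c) (sym φ-unfold) image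
    where
    σₙ≡c″ : Image.σₙ image ≡ c″
    σₙ≡c″ = just-injective (trans (sym (Image.last-σ image)) (last-∷ʳ (map (shiftUp c″) σ) c″))
    φ-unfold : φaux k n π ≡ σ ← c″
    φ-unfold = trans (cong (φstep k n π (φaux k (suc m))) (initLast-∷ʳ (ρ ∷ʳ a) c))
                     (cong (λ x → σ ← ∣ x ∣)
                           (trans (Image-j′ (+ c ℤ.- + n ℤ.+ + k) j-offset image) (cong +_ σₙ≡c″)))

φaux-image : ∀ k m π c → π ↭ oneTo (suc m) → DropsAtMost k 1 π → last π ≡ just c →
             Image k (suc m) π c (φaux k (suc m) π)
φaux-image k zero π c perm _ last≡ with ↭-singleton-inv perm
φaux-image k zero .(1 ∷ []) .1 _ _ refl | refl = record
  { σₙ = 1 ; rem = k ; perm = ↭-refl ; drops≤ = s≤s z≤n , tt ; last-σ = refl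
  ; rem≤k = ≤-refl ; σₙ-offset = refl ; division = base k }
  where base : ∀ k → suc k * 0 + k + 1 + suc k * 0 ≡ suc k * 1
        base = solve-∀
φaux-image k (suc m) π c perm drops≤ last≡ with List.initLast π
φaux-image k (suc m) .[] c _ _ () | []
φaux-image k (suc m) .(ρ′ ∷ʳ c′) c perm drops≤ last≡ | ρ′ ∷ʳ′ c′
  with refl ← just-injective (trans (sym (last-∷ʳ ρ′ c′)) last≡)
  with List.initLast ρ′
... | [] = contradiction (suc-injective (trans (↭-length perm) (length-oneTo (suc (suc m))))) 0≢1+n
... | ρ ∷ʳ′ a = φaux-∷ʳ∷ʳ-image ρ a c perm drops≤
  (φaux-image k m (standardize (ρ ∷ʳ a) c) (shiftDown c a) (standardize-perm (ρ ∷ʳ a) c perm)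
     (standardize-drops (ρ ∷ʳ a) c drops≤) (last-standardize ρ a c))

lemma2p2 : (n k : ℕ) → 1 ≤ n → (i j : ℕ) → i ≤ n ∸ 1 → j ≤ k →
    (π : List ℕ) → InΓ k n (+ i) (+ j) π →
    InΓ k n (i′ n k (+ i) (+ j)) (j′ n k (+ i) (+ j)) (φ k π)
lemma2p2 (suc m) k _ i j _ _ π ((perm , maxdrop≤) , des≡ , last≡ , c≡∣c∣)
  with refl ← ℤ.+-injective des≡ =
  subst (InΓ k n (i′ n k (+ des π) (+ j)) (j′ n k (+ des π) (+ j)))
        (cong (λ l → φaux k l π) (sym length-π))
    (Image⇒InΓ (+ j) j-offset (φaux-image k m π c perm (maxdrop≤⇒DropsAtMost 1 π maxdrop≤) last≡))
  where
  n = suc m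
  c = ∣ + n ℤ.- + k ℤ.+ + j ∣
  length-π : length π ≡ n
  length-π = trans (↭-length perm) (length-oneTo n)
  j-offset : + j ℤ.+ + n ≡ + c ℤ.+ + k
  j-offset = trans (ring (+ n) (+ k) (+ j)) (cong (ℤ._+ + k) c≡∣c∣)
    where ring : ∀ N K J → J ℤ.+ N ≡ N ℤ.- K ℤ.+ J ℤ.+ K
          ring = ℤ-Ring.solve-∀
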